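{- There is a universal constant $\beta_0$ such that the following holds for every $\beta\ge\beta_0$. Let $\epsilon\in(0,\tfrac12]$, $\delta\in(0,1)$, $c=80/\delta$, $s=\frac{\beta}{\delta^3\epsilon^4}$, and suppose $m\ge s$. Let the edges of $G$ arrive in a uniformly random order, and let $\tilde H$ be the set of all endpoints of the first $s$ edges of the stream. Then with probability at least $1-\frac{\delta}{2}$, $\tilde H$ contains every vertex $v$ with $\deg(v)\ge\epsilon^2m/c$.
   Context: $G=(V,E)$ is an undirected, unweighted, simple graph with $m$ edges; $\deg(v)$ is the degree of $v$.
   Formalization: The parameters $\beta$, ε and δ range over the rationals, and the universal constant $\beta_0$ is taken in ℚ. -}

module Defs where

open import Data.Nat as ℕ using (ℕ)
open import Data.Integer as ℤ using (ℤ; +_)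
open import Data.Fin using (Fin)
open import Data.Fin.Properties using (all?) renaming (_≟_ to _≟ᶠ_)
open import Data.Product using (_×_; _,_; proj₁; proj₂)
open import Data.Sum using (_⊎_)
open import Data.List using (List; []; _∷_; map; concatMap; length; filter; take)
open import Data.List.Relation.Unary.All using (All)
open import Data.List.Relation.Unary.Any using (Any; any?)
open import Data.List.Relation.Unary.AllPairs using (AllPairs)
open import Relation.Binary.PropositionalEquality using (_≡_; _≢_)
open import Relation.Nullary using (¬_; Dec)
open import Relation.Nullary.Decidable using (_⊎-dec_; _→-dec_)
open import Data.Rational as ℚ using (ℚ; 0ℚ; 1ℚ; _*_; _-_; _÷_; _<_; _≤_; floor; Positive; positive)
open import Data.Rational.Properties using (_≤?_; pos*pos⇒pos; pos⇒nonZero; 1/pos⇒pos)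

-- An edge is stored as an (ordered) pair of its two endpoints; the edge
-- list has no loops and no two entries representing the same
-- unordered pair {u,v}.

SameEdge : ∀ {n} → Fin n × Fin n → Fin n × Fin n → Set
SameEdge (a , b) (c , d) = (a ≡ c × b ≡ d) ⊎ (a ≡ d × b ≡ c)

record Graph : Set where
  field
    n        : ℕ
    edges    : List (Fin n × Fin n)
    loopless : All (λ e → proj₁ e ≢ proj₂ e) edges
    noMulti  : AllPairs (λ e f → ¬ SameEdge e f) edges

open Graph public

numEdges : Graph → ℕ
numEdges G = length (edges G)

Incident : ∀ {n} → Fin n → Fin n × Fin n → Set
Incident v e = v ≡ proj₁ e ⊎ v ≡ proj₂ e

incident? : ∀ {n} (v : Fin n) (e : Fin n × Fin n) → Dec (Incident v e)
incident? v e = (v ≟ᶠ proj₁ e) ⊎-dec (v ≟ᶠ proj₂ e)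

deg : (G : Graph) → Fin (n G) → ℕ
deg G v = length (filter (incident? v) (edges G))

-- All orderings of a list (insertion construction); for a list of m
-- distinct elements this lists each of the m! orderings exactly once.

insertions : ∀ {A : Set} → A → List A → List (List A)
insertions x []       = (x ∷ []) ∷ []
insertions x (y ∷ ys) = (x ∷ y ∷ ys) ∷ map (y ∷_) (insertions x ys)

orderings : ∀ {A : Set} → List A → List (List A)
orderings []       = [] ∷ []
orderings (x ∷ xs) = concatMap (insertions x) (orderings xs)

ℕ→ℚ : ℕ → ℚ
ℕ→ℚ k = (+ k) ℚ./ 1

sParam : (β δ ε : ℚ) → 0ℚ < δ → 0ℚ < ε → ℚ
sParam β δ ε 0<δ 0<ε =
  let instance
        pδ : Positive δ
        pδ = positive 0<δ
        pε : Positive ε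
        pε = positive 0<ε
        pδ2 : Positive (δ * δ)
        pδ2 = pos*pos⇒pos δ δ
        pδ3 : Positive (δ * δ * δ)
        pδ3 = pos*pos⇒pos (δ * δ) δ
        pε2 : Positive (ε * ε)
        pε2 = pos*pos⇒pos ε ε
        pε3 : Positive (ε * ε * ε)
        pε3 = pos*pos⇒pos (ε * ε) ε
        pε4 : Positive (ε * ε * ε * ε)
        pε4 = pos*pos⇒pos (ε * ε * ε) ε
        pd : Positive ((δ * δ * δ) * (ε * ε * ε * ε))
        pd = pos*pos⇒pos (δ * δ * δ) (ε * ε * ε * ε)
        nz : ℚ.NonZero ((δ * δ * δ) * (ε * ε * ε * ε))
        nz = pos⇒nonZero ((δ * δ * δ) * (ε * ε * ε * ε))
  in β ÷ ((δ * δ * δ) * (ε * ε * ε * ε))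

cParam : (δ : ℚ) → 0ℚ < δ → ℚ
cParam δ 0<δ =
  let instance
        pδ : Positive δ
        pδ = positive 0<δ
        nz : ℚ.NonZero δ
        nz = pos⇒nonZero δ
  in ℕ→ℚ 80 ÷ δ

threshold : (G : Graph) (δ ε : ℚ) → 0ℚ < δ → ℚ
threshold G δ ε 0<δ =
  let instance
        pδ : Positive δ
        pδ = positive 0<δ
        nzδ : ℚ.NonZero δ
        nzδ = pos⇒nonZero δ
        pinv : Positive (ℚ.1/ δ)
        pinv = 1/pos⇒pos δ
        pc : Positive (cParam δ 0<δ)
        pc = pos*pos⇒pos (ℕ→ℚ 80) (ℚ.1/ δ)
        nzc : ℚ.NonZero (cParam δ 0<δ)
        nzc = pos⇒nonZero (cParam δ 0<δ)
  in (ε * ε * ℕ→ℚ (numEdges G)) ÷ cParam δ 0<δ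

Endpoint : ∀ {n} → Fin n → List (Fin n × Fin n) → Set
Endpoint v es = Any (Incident v) es

CoversHeavy : (G : Graph) (t : ℚ) (k : ℕ) → List (Fin (n G) × Fin (n G)) → Set
CoversHeavy G t k σ = ∀ v → t ≤ ℕ→ℚ (deg G v) → Endpoint v (take k σ)

coversHeavy? : (G : Graph) (t : ℚ) (k : ℕ) (σ : List (Fin (n G) × Fin (n G))) → Dec (CoversHeavy G t k σ)
coversHeavy? G t k σ = all? (λ v → (t ≤? ℕ→ℚ (deg G v)) →-dec any? (incident? v) (take k σ))

goodCount : (G : Graph) (t : ℚ) (k : ℕ) → ℕ
goodCount G t k = length (filter (coversHeavy? G t k) (orderings (edges G)))

totalCount : Graph → ℕ
totalCount G = length (orderings (edges G))

-- Pr[event] ≥ p, for the uniform distribution on orderings, written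
-- without division:  p · (#orderings) ≤ #good orderings.
ProbAtLeast : (G : Graph) (t : ℚ) (k : ℕ) (p : ℚ) → Set
ProbAtLeast G t k p = p * ℕ→ℚ (totalCount G) ≤ ℕ→ℚ (goodCount G t k)

-- Let m be the number of edges and k = ⌊s⌋, and write a↓k for the falling factorial.
-- Among the m! stream orders, exactly (m - d)↓k · (m - k)! put no edge at a given
-- vertex v of degree d into the first k positions, and (m - d)↓k · (m + k d) ≤ m · m↓k,
-- so v is missed with probability at most m / (k d). For a vertex of degree d ≥ t this
-- is at most m d / (k t²), so by the union bound and the handshake bound Σ d ≤ 2m the
-- probability that some vertex of degree ≥ t is missed is at most 2m² / (k t²). With
-- t = ε² m δ / 80 and k ≥ s - 1 this is at most δ / 2 as soon as β ≥ 25601.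

module Submission where

module Counting where

  open import Algebra.Properties.CommutativeSemigroup using (interchange)
  open import Data.Bool using (true; false)
  open import Data.List using (List; []; _∷_; [_]; _++_; map; concatMap; length; filter)
  open import Data.List.Properties using (map-cong; length-++; filter-++; filter-accept; filter-none; filter-≐)
  open import Data.List.Relation.Unary.All as All using (All; []; _∷_)
  open import Data.List.Relation.Unary.AllPairs using ([]; _∷_)
  open import Data.List.Relation.Unary.Any as Any using (Any; here; there)
  open import Data.List.Relation.Unary.Unique.Propositional using (Unique)
  open import Data.Nat using (ℕ; suc; _+_; _*_; _≤_; z≤n; s≤s)
  open import Data.Nat.ListAction using (sum)
  open import Data.Nat.Properties
  open import Data.Nat.Tactic.RingSolver using (solve-∀)
  open import Function using (_∘_)
  open import Level using (Level)
  open import Relation.Binary.Definitions using (DecidableEquality)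
  open import Relation.Binary.PropositionalEquality using (_≡_; refl; sym; trans; cong; cong₂; module ≡-Reasoning)
  open import Relation.Nullary using (¬_; yes; no; does)
  open import Relation.Unary using (Pred; Decidable; _≐_)
  open import Relation.Unary.Properties using (∁?; _∪?_)

  private variable
    A B V : Set
    p q : Level

  count : {P : Pred A p} → Decidable P → List A → ℕ
  count P? xs = length (filter P? xs)

  module _ {P : Pred A p} (P? : Decidable P) where

    count-++ : ∀ xs ys → count P? (xs ++ ys) ≡ count P? xs + count P? ys
    count-++ xs ys = trans (cong length (filter-++ P? xs ys)) (length-++ (filter P? xs))

    count-∷ : ∀ x xs → count P? (x ∷ xs) ≡ count P? [ x ] + count P? xs
    count-∷ x = count-++ [ x ]

    count-[]-accept : ∀ {x} → P x → count P? [ x ] ≡ 1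
    count-[]-accept px = cong length (filter-accept P? px)

    count-map : (f : B → A) (xs : List B) → count P? (map f xs) ≡ count (P? ∘ f) xs
    count-map f []       = refl
    count-map f (x ∷ xs) with does (P? (f x))
    ... | true  = cong suc (count-map f xs)
    ... | false = count-map f xs

    count-∁+count : ∀ xs → count (∁? P?) xs + count P? xs ≡ length xs
    count-∁+count []       = refl
    count-∁+count (x ∷ xs) with does (P? x)
    ... | true  = trans (+-suc _ _) (cong suc (count-∁+count xs))
    ... | false = cong suc (count-∁+count xs)

  count-≐ : {P : Pred A p} {Q : Pred A q} (P? : Decidable P) (Q? : Decidable Q) → P ≐ Q →
    ∀ xs → count P? xs ≡ count Q? xs
  count-≐ P? Q? P≐Q xs = cong length (filter-≐ P? Q? P≐Q xs)

  count-∪ : {P : Pred A p} {Q : Pred A q} (P? : Decidable P) (Q? : Decidable Q) →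
    ∀ xs → count (P? ∪? Q?) xs ≤ count P? xs + count Q? xs
  count-∪ P? Q? []       = z≤n
  count-∪ P? Q? (x ∷ xs) with does (P? x) | does (Q? x)
  ... | true  | true  = s≤s (≤-trans (count-∪ P? Q? xs) (+-monoʳ-≤ (count P? xs) (n≤1+n _)))
  ... | true  | false = s≤s (count-∪ P? Q? xs)
  ... | false | true  = ≤-trans (s≤s (count-∪ P? Q? xs)) (≤-reflexive (sym (+-suc _ _)))
  ... | false | false = count-∪ P? Q? xs

  count-≟-unique : (_≟_ : DecidableEquality A) (a : A) {xs : List A} → Unique xs → count (_≟ a) xs ≤ 1
  count-≟-unique _≟_ a []                    = z≤n
  count-≟-unique _≟_ a {x ∷ xs} (x∉xs ∷ xs!) with x ≟ a
  ... | yes refl = s≤s (≤-reflexive (cong length (filter-none (_≟ x) (All.map (λ x≢y y≡x → x≢y (sym y≡x)) x∉xs))))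
  ... | no _     = count-≟-unique _≟_ a xs!

  -- count R? [ σ ] is the indicator of R σ.
  module _ {P : Pred A p} (P? : Decidable P) {R S : Pred B q} (R? : Decidable R) (S? : Decidable S) where

    count-concatMap-≤ : (f : B → List A) (α β : ℕ) (O : List B) →
      All (λ σ → count P? (f σ) ≤ α * count R? [ σ ] + β * count S? [ σ ]) O →
      count P? (concatMap f O) ≤ α * count R? O + β * count S? O
    count-concatMap-≤ f α β []      []               = z≤n
    count-concatMap-≤ f α β (σ ∷ O) (bound ∷ bounds) = begin
      count P? (f σ ++ concatMap f O)                        ≡⟨ count-++ P? (f σ) _ ⟩
      count P? (f σ) + count P? (concatMap f O)              ≤⟨ +-mono-≤ bound (count-concatMap-≤ f α β O bounds) ⟩
      (α * r + β * s) + (α * count R? O + β * count S? O)    ≡⟨ regroup α β r s _ _ ⟩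
      α * (r + count R? O) + β * (s + count S? O)            ≡⟨ sym (cong₂ (λ x y → α * x + β * y) (count-∷ R? σ O) (count-∷ S? σ O)) ⟩
      α * count R? (σ ∷ O) + β * count S? (σ ∷ O)            ∎
      where
      open ≤-Reasoning
      r = count R? [ σ ]
      s = count S? [ σ ]
      regroup : ∀ a b x y u v → (a * x + b * y) + (a * u + b * v) ≡ a * (x + u) + b * (y + v)
      regroup = solve-∀

  sum-map-+ : (f g : A → ℕ) (xs : List A) → sum (map (λ x → f x + g x) xs) ≡ sum (map f xs) + sum (map g xs)
  sum-map-+ f g []       = refl
  sum-map-+ f g (x ∷ xs) = begin
    f x + g x + sum (map (λ x → f x + g x) xs)      ≡⟨ cong (f x + g x +_) (sum-map-+ f g xs) ⟩
    f x + g x + (sum (map f xs) + sum (map g xs))   ≡⟨ interchange +-commutativeSemigroup (f x) (g x) _ _ ⟩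
    f x + sum (map f xs) + (g x + sum (map g xs))   ∎
    where open ≡-Reasoning

  sum-map-filter-≤ : {P : Pred A p} (P? : Decidable P) (f : A → ℕ) (xs : List A) →
    sum (map f (filter P? xs)) ≤ sum (map f xs)
  sum-map-filter-≤ P? f []       = z≤n
  sum-map-filter-≤ P? f (x ∷ xs) with does (P? x)
  ... | true  = +-monoʳ-≤ (f x) (sum-map-filter-≤ P? f xs)
  ... | false = ≤-trans (sum-map-filter-≤ P? f xs) (m≤n+m _ (f x))

  any-positive⇒1≤sum : (f : A → ℕ) {xs : List A} → Any (λ x → 1 ≤ f x) xs → 1 ≤ sum (map f xs)
  any-positive⇒1≤sum f (here 1≤fx) = ≤-trans 1≤fx (m≤m+n _ _)
  any-positive⇒1≤sum f (there any) = ≤-trans (any-positive⇒1≤sum f any) (m≤n+m _ _)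

  module _ {R : V → Pred B q} (R? : ∀ v → Decidable (R v)) (vs : List V) where

    sum-count-∷ : ∀ σ O → sum (map (λ v → count (R? v) (σ ∷ O)) vs) ≡
      sum (map (λ v → count (R? v) [ σ ]) vs) + sum (map (λ v → count (R? v) O) vs)
    sum-count-∷ σ O = trans (cong sum (map-cong (λ v → count-∷ (R? v) σ O) vs)) (sum-map-+ _ _ vs)

    sum-count-comm : ∀ es → sum (map (λ v → count (R? v) es) vs) ≡ sum (map (λ e → count (λ v → R? v e) vs) es)
    sum-count-comm []       = sum-zero vs
      where
      sum-zero : (vs : List V) → sum (map (λ _ → 0) vs) ≡ 0
      sum-zero []       = refl
      sum-zero (_ ∷ vs) = sum-zero vs
    sum-count-comm (e ∷ es) = trans (sum-count-∷ e es) (cong₂ _+_ (sum-singleton vs) (sum-count-comm es))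
      where
      sum-singleton : ∀ vs → sum (map (λ v → count (R? v) [ e ]) vs) ≡ count (λ v → R? v e) vs
      sum-singleton []       = refl
      sum-singleton (v ∷ vs) with does (R? v e)
      ... | true  = cong suc (sum-singleton vs)
      ... | false = sum-singleton vs

    union-bound : {Q : Pred B p} (Q? : Decidable Q) → (∀ σ → ¬ Q σ → Any (λ v → R v σ) vs) →
      (O : List B) → length O ≤ count Q? O + sum (map (λ v → count (R? v) O) vs)
    union-bound Q? ¬Q⇒R []      = z≤n
    union-bound Q? ¬Q⇒R (σ ∷ O) = begin
      suc (length O)                                             ≤⟨ +-mono-≤ σ-counted (union-bound Q? ¬Q⇒R O) ⟩
      (count Q? [ σ ] + missed [ σ ]) + (count Q? O + missed O)  ≡⟨ interchange +-commutativeSemigroup (count Q? [ σ ]) (missed [ σ ]) _ _ ⟩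
      (count Q? [ σ ] + count Q? O) + (missed [ σ ] + missed O)  ≡⟨ sym (cong₂ _+_ (count-∷ Q? σ O) (sum-count-∷ σ O)) ⟩
      count Q? (σ ∷ O) + missed (σ ∷ O)                          ∎
      where
      open ≤-Reasoning
      missed : List B → ℕ
      missed O = sum (map (λ v → count (R? v) O) vs)
      σ-counted : 1 ≤ count Q? [ σ ] + missed [ σ ]
      σ-counted with Q? σ
      ... | yes _ = s≤s z≤n
      ... | no ¬q = any-positive⇒1≤sum _ (Any.map (λ r → ≤-reflexive (sym (count-[]-accept (R? _) r))) (¬Q⇒R σ ¬q))

module FallingFactorial where

  open import Algebra.Properties.CommutativeSemigroup using (x∙yz≈y∙xz)
  open import Data.Nat using (ℕ; zero; suc; _+_; _*_; _∸_; _≤_; z≤n; _!; NonZero)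
  open import Data.Nat.Combinatorics using ([n-k]*[n-k-1]!≡[n-k]!)
  open import Data.Nat.Properties
  open import Data.Nat.Tactic.RingSolver using (solve-∀)
  open import Data.Sum using (inj₁; inj₂)
  open import Relation.Binary.PropositionalEquality using (_≡_; refl; sym; trans; cong; module ≡-Reasoning)

  infix 8 _↓_

  _↓_ : ℕ → ℕ → ℕ
  n     ↓ zero  = 1
  zero  ↓ suc k = 0
  suc n ↓ suc k = suc n * n ↓ k

  ↓-rec : ∀ a j → suc a ↓ suc j ≡ suc j * a ↓ j + a ↓ suc j
  ↓-rec zero    zero    = refl
  ↓-rec zero    (suc j) = sym (trans (+-identityʳ _) (*-zeroʳ (suc (suc j))))
  ↓-rec (suc a) zero    = identity a
    where
    identity : ∀ a → suc (suc a) * 1 ≡ 1 * 1 + suc a * 1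
    identity = solve-∀
  ↓-rec (suc a) (suc j) = begin
    suc (suc a) * (suc a * a ↓ j)                       ≡⟨ distribute (suc a) (a ↓ j) ⟩
    suc a * (a ↓ j + suc a * a ↓ j)                     ≡⟨ cong (λ x → suc a * (a ↓ j + x)) (↓-rec a j) ⟩
    suc a * (a ↓ j + (suc j * a ↓ j + a ↓ suc j))       ≡⟨ regroup (suc a) (a ↓ j) (a ↓ suc j) j ⟩
    suc (suc j) * (suc a * a ↓ j) + suc a * a ↓ suc j   ∎
    where
    open ≡-Reasoning
    distribute : ∀ n x → suc n * (n * x) ≡ n * (x + n * x)
    distribute = solve-∀
    regroup : ∀ n x y j → n * (x + (suc j * x + y)) ≡ suc (suc j) * (n * x) + n * y
    regroup = solve-∀

  ↓*[n∸k]!≤n! : ∀ n k → n ↓ k * (n ∸ k) ! ≤ n !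
  ↓*[n∸k]!≤n! n       zero    = ≤-reflexive (*-identityˡ (n !))
  ↓*[n∸k]!≤n! zero    (suc k) = z≤n
  ↓*[n∸k]!≤n! (suc n) (suc k) = begin
    suc n * n ↓ k * (n ∸ k) !     ≡⟨ *-assoc (suc n) (n ↓ k) ((n ∸ k) !) ⟩
    suc n * (n ↓ k * (n ∸ k) !)   ≤⟨ *-monoʳ-≤ (suc n) (↓*[n∸k]!≤n! n k) ⟩
    suc n * n !                   ∎
    where open ≤-Reasoning

  [n∸j]*c≤b*[n∸j]! : ∀ {n j} b c → j ≤ n → (suc j ≤ n → c ≤ b * (n ∸ suc j) !) → (n ∸ j) * c ≤ b * (n ∸ j) !
  [n∸j]*c≤b*[n∸j]! {n} {j} b c j≤n c≤ with m≤n⇒m<n∨m≡n j≤n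
  ... | inj₂ refl rewrite n∸n≡0 n = z≤n
  ... | inj₁ j<n  = begin
    (n ∸ j) * c                     ≤⟨ *-monoʳ-≤ (n ∸ j) (c≤ j<n) ⟩
    (n ∸ j) * (b * (n ∸ suc j) !)   ≡⟨ x∙yz≈y∙xz *-commutativeSemigroup (n ∸ j) b _ ⟩
    b * ((n ∸ j) * (n ∸ suc j) !)   ≡⟨ cong (b *_) ([n-k]*[n-k-1]!≡[n-k]! j<n) ⟩
    b * (n ∸ j) !                   ∎
    where open ≤-Reasoning

  private
    ↓-ratio-step : ∀ a d k → .{{NonZero (a + d + k * d)}} →
      a ↓ k * (a + d + k * d) ≤ (a + d) * (a + d) ↓ k →
      suc a ↓ suc k * (suc a + d + suc k * d) ≤ (suc a + d) * (suc a + d) ↓ suc k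
    ↓-ratio-step a d k ih = *-cancelʳ-≤ _ _ (a + d + k * d) (begin
      suc a * x * (suc a + d + suc k * d) * (a + d + k * d)        ≡⟨ regroup a d k x ⟩
      suc a * (suc a + d + suc k * d) * (x * (a + d + k * d))      ≤⟨ *-monoʳ-≤ (suc a * (suc a + d + suc k * d)) ih ⟩
      suc a * (suc a + d + suc k * d) * ((a + d) * y)              ≤⟨ m≤m+n _ (y * slack) ⟩
      suc a * (suc a + d + suc k * d) * ((a + d) * y) + y * slack  ≡⟨ sym (expand a d k y) ⟩
      (suc a + d) * (suc (a + d) * y) * (a + d + k * d)            ∎)
      where
      open ≤-Reasoning
      x = a ↓ k
      y = (a + d) ↓ k
      slack = suc (a + d) * (k * d) + (a + d) * d * (k * d) + (a + d) * d * d
      regroup : ∀ a d k x → suc a * x * (suc a + d + suc k * d) * (a + d + k * d) ≡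
        suc a * (suc a + d + suc k * d) * (x * (a + d + k * d))
      regroup = solve-∀
      expand : ∀ a d k y → (suc a + d) * (suc (a + d) * y) * (a + d + k * d) ≡
        suc a * (suc a + d + suc k * d) * ((a + d) * y) + y * (suc (a + d) * (k * d) + (a + d) * d * (k * d) + (a + d) * d * d)
      expand = solve-∀

  -- a ↓ k / (a + d) ↓ k is the probability that k draws without replacement from
  -- a + d items avoid d marked ones. The clauses for a = 1 split on d only so that
  -- the factor cancelled in ↓-ratio-step is visibly nonzero.
  ↓-ratio : ∀ a d k → a ↓ k * (a + d + k * d) ≤ (a + d) * (a + d) ↓ k
  ↓-ratio a             d       zero    = ≤-reflexive (identity a d)
    where
    identity : ∀ a d → 1 * (a + d + 0 * d) ≡ (a + d) * 1
    identity = solve-∀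
  ↓-ratio zero          d       (suc k) = z≤n
  ↓-ratio (suc zero)    zero    (suc k) = ≤-reflexive (identity (0 ↓ k) k)
    where
    identity : ∀ x k → 1 * x * (1 + 0 + suc k * 0) ≡ (1 + 0) * (1 * x)
    identity = solve-∀
  ↓-ratio (suc zero)    (suc d) (suc k) = ↓-ratio-step zero (suc d) k (↓-ratio zero (suc d) k)
  ↓-ratio (suc (suc a)) d       (suc k) = ↓-ratio-step (suc a) d k (↓-ratio (suc a) d k)

module Orderings where

  open import Defs using (insertions; orderings)
  open Counting
  open FallingFactorial
  open import Algebra.Properties.CommutativeSemigroup using (xy∙z≈xz∙y)
  open import Data.List using (List; []; _∷_; [_]; _++_; map; concatMap; length; take)
  open import Data.List.Properties using (length-map; length-++; filter-none)
  open import Data.List.Relation.Unary.All as All using (All; []; _∷_)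
  open import Data.List.Relation.Unary.All.Properties using (++⁺; map⁺)
  open import Data.List.Relation.Unary.Any using (Any; here; there; any?)
  open import Data.Nat using (ℕ; zero; suc; pred; _+_; _*_; _∸_; _≤_; z≤n; s≤s; _!)
  open import Data.Nat.Properties
  open import Data.Product using (_,_)
  open import Function using (_∘_)
  open import Level using (Level)
  open import Relation.Binary.PropositionalEquality using (_≡_; refl; sym; trans; cong; cong₂; subst; module ≡-Reasoning)
  open import Relation.Nullary using (¬_; Dec; yes; no; ¬?)
  open import Relation.Unary using (Pred; Decidable; _≐_)
  open import Relation.Unary.Properties using (∁?)

  private variable
    A : Set
    p : Level

  length-insertions : (x : A) (σ : List A) → length (insertions x σ) ≡ suc (length σ)
  length-insertions x []      = refl
  length-insertions x (y ∷ σ) = cong suc (trans (length-map (y ∷_) (insertions x σ)) (length-insertions x σ))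

  insertions-length : (x : A) (σ : List A) → All (λ τ → length τ ≡ suc (length σ)) (insertions x σ)
  insertions-length x []      = refl ∷ []
  insertions-length x (y ∷ σ) = refl ∷ map⁺ (All.map (cong suc) (insertions-length x σ))

  orderings-length : (L : List A) → All (λ σ → length σ ≡ length L) (orderings L)
  orderings-length []       = refl ∷ []
  orderings-length (x ∷ xs) = concat-insertions (orderings xs) (orderings-length xs)
    where
    concat-insertions : ∀ O → All (λ σ → length σ ≡ length xs) O →
      All (λ τ → length τ ≡ suc (length xs)) (concatMap (insertions x) O)
    concat-insertions []      []       = []
    concat-insertions (σ ∷ O) (l ∷ ls) =
      ++⁺ (subst (λ n → All (λ τ → length τ ≡ suc n) (insertions x σ)) l (insertions-length x σ)) (concat-insertions O ls)

  length-orderings : (L : List A) → length (orderings L) ≡ length L !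
  length-orderings []       = refl
  length-orderings (x ∷ xs) =
    trans (length-concat-insertions (orderings xs) (orderings-length xs)) (cong (suc (length xs) *_) (length-orderings xs))
    where
    length-concat-insertions : ∀ O → All (λ σ → length σ ≡ length xs) O →
      length (concatMap (insertions x) O) ≡ suc (length xs) * length O
    length-concat-insertions []      []       = sym (*-zeroʳ (suc (length xs)))
    length-concat-insertions (σ ∷ O) (l ∷ ls) = begin
      length (insertions x σ ++ concatMap (insertions x) O)           ≡⟨ length-++ (insertions x σ) ⟩
      length (insertions x σ) + length (concatMap (insertions x) O)   ≡⟨ cong₂ _+_ (trans (length-insertions x σ) (cong suc l)) (length-concat-insertions O ls) ⟩
      suc (length xs) + suc (length xs) * length O                    ≡⟨ sym (*-suc (suc (length xs)) (length O)) ⟩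
      suc (length xs) * suc (length O)                                ∎
      where open ≡-Reasoning

  module _ {P : Pred A p} (P? : Decidable P) where

    Misses : ℕ → Pred (List A) p
    Misses k σ = ¬ Any P (take k σ)

    misses? : ∀ k → Decidable (Misses k)
    misses? k σ = ¬? (any? P? (take k σ))

    count-misses-zero : (O : List (List A)) → count (misses? 0) O ≡ length O
    count-misses-zero []      = refl
    count-misses-zero (_ ∷ O) = cong suc (count-misses-zero O)

    count-misses-∷-reject : ∀ {y} → ¬ P y → ∀ j O → count (misses? (suc j)) (map (y ∷_) O) ≡ count (misses? j) O
    count-misses-∷-reject {y} ¬py j O = trans (count-map (misses? (suc j)) (y ∷_) O) (count-≐ _ (misses? j) shift O)
      where
      shift : (Misses (suc j) ∘ (y ∷_)) ≐ Misses j
      shift = (λ m any → m (there any)) , (λ { m (here py) → ¬py py ; m (there any) → m any })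

    count-misses-∷-accept : ∀ {y} → P y → ∀ j O → count (misses? (suc j)) (map (y ∷_) O) ≡ 0
    count-misses-∷-accept {y} py j O =
      trans (count-map (misses? (suc j)) (y ∷_) O) (cong length (filter-none _ (All.universal (λ _ m → m (here py)) O)))

    insertions-misses-zero : ∀ {x} σ → count (misses? 0) (insertions x σ) ≤ suc (length σ) * count (misses? 0) [ σ ]
    insertions-misses-zero {x} σ = ≤-reflexive (begin
      count (misses? 0) (insertions x σ)   ≡⟨ count-misses-zero (insertions x σ) ⟩
      length (insertions x σ)              ≡⟨ length-insertions x σ ⟩
      suc (length σ)                       ≡⟨ sym (*-identityʳ _) ⟩
      suc (length σ) * 1                   ∎)
      where open ≡-Reasoning

    -- Inserting x at one of the last length σ + 1 - k positions leaves the first k entries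
    -- of σ in the window; inserting it earlier pushes the k-th entry out, which can help
    -- only when x is unmarked.
    insertions-misses-marked : ∀ {x} → P x → ∀ k σ →
      count (misses? k) (insertions x σ) ≤ (suc (length σ) ∸ k) * count (misses? k) [ σ ]
    insertions-misses-marked px zero    σ  = insertions-misses-zero σ
    insertions-misses-marked px (suc j) [] = ≤-trans (≤-reflexive (count-misses-∷-accept px j [ [] ])) z≤n
    insertions-misses-marked {x} px (suc j) (y ∷ σ) = begin
      count (misses? (suc j)) (insertions x (y ∷ σ))           ≡⟨ count-∷ (misses? (suc j)) (x ∷ y ∷ σ) _ ⟩
      count (misses? (suc j)) [ x ∷ y ∷ σ ] + later             ≡⟨ cong (_+ later) (count-misses-∷-accept px j [ y ∷ σ ]) ⟩
      later                                                     ≤⟨ later-insertions (P? y) ⟩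
      (suc (length σ) ∸ j) * count (misses? (suc j)) [ y ∷ σ ]  ∎
      where
      open ≤-Reasoning
      later = count (misses? (suc j)) (map (y ∷_) (insertions x σ))
      later-insertions : Dec (P y) → later ≤ (suc (length σ) ∸ j) * count (misses? (suc j)) [ y ∷ σ ]
      later-insertions (yes py) = ≤-trans (≤-reflexive (count-misses-∷-accept py j (insertions x σ))) z≤n
      later-insertions (no ¬py) rewrite count-misses-∷-reject ¬py j (insertions x σ) | count-misses-∷-reject ¬py j [ σ ] =
        insertions-misses-marked px j σ

    insertions-misses-unmarked : ∀ {x} → ¬ P x → ∀ k σ →
      count (misses? k) (insertions x σ) ≤ k * count (misses? (pred k)) [ σ ] + (suc (length σ) ∸ k) * count (misses? k) [ σ ]
    insertions-misses-unmarked ¬px zero σ = insertions-misses-zero σ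
    insertions-misses-unmarked {x} ¬px (suc j) [] = begin
      count (misses? (suc j)) (insertions x [])   ≡⟨ count-misses-∷-reject ¬px j [ [] ] ⟩
      count (misses? j) [ [] ]                    ≤⟨ m≤n*m _ (suc j) ⟩
      suc j * count (misses? j) [ [] ]            ≤⟨ m≤m+n _ _ ⟩
      suc j * count (misses? j) [ [] ] + _        ∎
      where open ≤-Reasoning
    insertions-misses-unmarked {x} ¬px (suc j) (y ∷ σ) = begin
      count (misses? (suc j)) (insertions x (y ∷ σ))    ≡⟨ count-∷ (misses? (suc j)) (x ∷ y ∷ σ) _ ⟩
      count (misses? (suc j)) [ x ∷ y ∷ σ ] + later      ≡⟨ cong (_+ later) (count-misses-∷-reject ¬px j [ y ∷ σ ]) ⟩
      front + later                                      ≤⟨ +-monoʳ-≤ front (later-insertions (P? y)) ⟩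
      front + (j * front + (suc (length σ) ∸ j) * rest)  ≡⟨ sym (+-assoc front _ _) ⟩
      suc j * front + (suc (length σ) ∸ j) * rest        ∎
      where
      open ≤-Reasoning
      front = count (misses? j) [ y ∷ σ ]
      rest  = count (misses? (suc j)) [ y ∷ σ ]
      later = count (misses? (suc j)) (map (y ∷_) (insertions x σ))
      later-insertions : Dec (P y) → later ≤ j * front + (suc (length σ) ∸ j) * rest
      later-insertions (yes py) = ≤-trans (≤-reflexive (count-misses-∷-accept py j (insertions x σ))) z≤n
      later-insertions (no ¬py) = begin
        later
          ≡⟨ count-misses-∷-reject ¬py j (insertions x σ) ⟩
        count (misses? j) (insertions x σ)
          ≤⟨ insertions-misses-unmarked ¬px j σ ⟩
        j * count (misses? (pred j)) [ σ ] + (suc (length σ) ∸ j) * count (misses? j) [ σ ]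
          ≡⟨ cong₂ _+_ (shift j) (cong ((suc (length σ) ∸ j) *_) (sym (count-misses-∷-reject ¬py j [ σ ]))) ⟩
        j * front + (suc (length σ) ∸ j) * rest
          ∎
        where
        shift : ∀ i → i * count (misses? (pred i)) [ σ ] ≡ i * count (misses? i) [ y ∷ σ ]
        shift zero    = refl
        shift (suc i) = cong (suc i *_) (sym (count-misses-∷-reject ¬py i [ σ ]))

    misses-orderings : ∀ L k → k ≤ length L → count (misses? k) (orderings L) ≤ count (∁? P?) L ↓ k * (length L ∸ k) !
    misses-orderings L zero _ = ≤-reflexive (trans (count-misses-zero (orderings L)) (trans (length-orderings L) (sym (*-identityˡ _))))
    misses-orderings (x ∷ xs) (suc j) (s≤s j≤n) with P? x
    ... | yes px = begin
      count (misses? (suc j)) (concatMap (insertions x) O)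
        ≤⟨ count-concatMap-≤ (misses? (suc j)) (misses? j) (misses? (suc j)) (insertions x) 0 (n ∸ j) O
             (All.map (λ {σ} → bound {σ}) (orderings-length xs)) ⟩
      (n ∸ j) * count (misses? (suc j)) O
        ≤⟨ [n∸j]*c≤b*[n∸j]! (a ↓ suc j) _ j≤n (misses-orderings xs (suc j)) ⟩
      a ↓ suc j * (n ∸ j) !
        ∎
      where
      open ≤-Reasoning
      n = length xs
      a = count (∁? P?) xs
      O = orderings xs
      bound : ∀ {σ} → length σ ≡ n →
        count (misses? (suc j)) (insertions x σ) ≤ 0 * count (misses? j) [ σ ] + (n ∸ j) * count (misses? (suc j)) [ σ ]
      bound {σ} l rewrite sym l = insertions-misses-marked px (suc j) σ
    ... | no ¬px = begin
      count (misses? (suc j)) (concatMap (insertions x) O)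
        ≤⟨ count-concatMap-≤ (misses? (suc j)) (misses? j) (misses? (suc j)) (insertions x) (suc j) (n ∸ j) O
             (All.map (λ {σ} → bound {σ}) (orderings-length xs)) ⟩
      suc j * count (misses? j) O + (n ∸ j) * count (misses? (suc j)) O
        ≤⟨ +-mono-≤ (*-monoʳ-≤ (suc j) (misses-orderings xs j j≤n))
                    ([n∸j]*c≤b*[n∸j]! (a ↓ suc j) _ j≤n (misses-orderings xs (suc j))) ⟩
      suc j * (a ↓ j * (n ∸ j) !) + a ↓ suc j * (n ∸ j) !
        ≡⟨ cong (_+ a ↓ suc j * (n ∸ j) !) (sym (*-assoc (suc j) (a ↓ j) _)) ⟩
      suc j * a ↓ j * (n ∸ j) ! + a ↓ suc j * (n ∸ j) !
        ≡⟨ sym (*-distribʳ-+ ((n ∸ j) !) (suc j * a ↓ j) (a ↓ suc j)) ⟩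
      (suc j * a ↓ j + a ↓ suc j) * (n ∸ j) !
        ≡⟨ cong (_* (n ∸ j) !) (sym (↓-rec a j)) ⟩
      suc a ↓ suc j * (n ∸ j) !
        ∎
      where
      open ≤-Reasoning
      n = length xs
      a = count (∁? P?) xs
      O = orderings xs
      bound : ∀ {σ} → length σ ≡ n →
        count (misses? (suc j)) (insertions x σ) ≤ suc j * count (misses? j) [ σ ] + (n ∸ j) * count (misses? (suc j)) [ σ ]
      bound {σ} l rewrite sym l = insertions-misses-unmarked ¬px (suc j) σ

    misses-orderings-ratio : ∀ L k → k ≤ length L → count (misses? k) (orderings L) * (k * count P? L) ≤ length L * length (orderings L)
    misses-orderings-ratio L k k≤m = begin
      c * (k * d)                           ≤⟨ *-monoʳ-≤ c (m≤n+m (k * d) (a + d)) ⟩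
      c * (a + d + k * d)                   ≤⟨ *-monoˡ-≤ (a + d + k * d) (misses-orderings L k k≤m) ⟩
      a ↓ k * (m ∸ k) ! * (a + d + k * d)   ≡⟨ xy∙z≈xz∙y *-commutativeSemigroup (a ↓ k) ((m ∸ k) !) (a + d + k * d) ⟩
      a ↓ k * (a + d + k * d) * (m ∸ k) !   ≤⟨ *-monoˡ-≤ ((m ∸ k) !) (↓-ratio a d k) ⟩
      (a + d) * (a + d) ↓ k * (m ∸ k) !     ≡⟨ cong (λ n → n * n ↓ k * (m ∸ k) !) (count-∁+count P? L) ⟩
      m * m ↓ k * (m ∸ k) !                 ≡⟨ *-assoc m (m ↓ k) ((m ∸ k) !) ⟩
      m * (m ↓ k * (m ∸ k) !)               ≤⟨ *-monoʳ-≤ m (↓*[n∸k]!≤n! m k) ⟩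
      m * m !                               ≡⟨ cong (m *_) (sym (length-orderings L)) ⟩
      m * length (orderings L)              ∎
      where
      open ≤-Reasoning
      c = count (misses? k) (orderings L)
      a = count (∁? P?) L
      d = count P? L
      m = length L

module HeavyVertices where

  open import Defs
  open Counting
  open Orderings
  open import Data.Fin using (Fin)
  open import Data.Fin.Properties using (_≟_; ¬∀⟶∃¬)
  open import Data.List using (List; []; _∷_; map; filter; length; allFin; take)
  open import Data.List.Membership.Propositional using (lose)
  open import Data.List.Membership.Propositional.Properties using (∈-allFin; ∈-filter⁺)
  open import Data.List.Relation.Unary.Any using (Any; any?)
  open import Data.List.Relation.Unary.Unique.Propositional.Properties using (allFin⁺)
  open import Data.Nat using (ℕ; _+_; _*_; _≤_; z≤n)
  open import Data.Nat.ListAction using (sum)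
  open import Data.Nat.Properties using (≤-trans; ≤-reflexive; +-mono-≤; *-suc)
  open import Data.Product using (_×_; _,_; proj₁; proj₂)
  open import Data.Rational as ℚ using (ℚ)
  open import Data.Rational.Properties using () renaming (_≤?_ to _≤ℚ?_)
  open import Relation.Binary.PropositionalEquality using (sym)
  open import Relation.Nullary using (¬_; contradiction)
  open import Relation.Nullary.Decidable using (_→-dec_; decidable-stable)
  open import Relation.Unary using (Decidable)

  Heavy : (G : Graph) → ℚ → Fin (n G) → Set
  Heavy G t v = t ℚ.≤ ℕ→ℚ (deg G v)

  heavy? : (G : Graph) (t : ℚ) → Decidable (Heavy G t)
  heavy? G t v = t ≤ℚ? ℕ→ℚ (deg G v)

  heavyVertices : (G : Graph) → ℚ → List (Fin (n G))
  heavyVertices G t = filter (heavy? G t) (allFin (n G))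

  missedOrderings : (G : Graph) → ℕ → Fin (n G) → ℕ
  missedOrderings G k v = count (misses? (incident? v) k) (orderings (edges G))

  endpoints-≤2 : ∀ {k} (e : Fin k × Fin k) → count (λ v → incident? v e) (allFin k) ≤ 2
  endpoints-≤2 {k} (a , b) = ≤-trans (count-∪ (_≟ a) (_≟ b) (allFin k))
    (+-mono-≤ (count-≟-unique _≟_ a (allFin⁺ k)) (count-≟-unique _≟_ b (allFin⁺ k)))

  degree-sum-≤ : (G : Graph) → sum (map (deg G) (allFin (n G))) ≤ 2 * numEdges G
  degree-sum-≤ G = ≤-trans (≤-reflexive (sum-count-comm incident? (allFin (n G)) (edges G))) (edge-sum (edges G))
    where
    edge-sum : (es : List (Fin (n G) × Fin (n G))) →
      sum (map (λ e → count (λ v → incident? v e) (allFin (n G))) es) ≤ 2 * length es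
    edge-sum []       = z≤n
    edge-sum (e ∷ es) = ≤-trans (+-mono-≤ (endpoints-≤2 e) (edge-sum es)) (≤-reflexive (sym (*-suc 2 _)))

  heavy-degree-sum-≤ : (G : Graph) (t : ℚ) → sum (map (deg G) (heavyVertices G t)) ≤ 2 * numEdges G
  heavy-degree-sum-≤ G t = ≤-trans (sum-map-filter-≤ (heavy? G t) (deg G) (allFin (n G))) (degree-sum-≤ G)

  missedOrderings-bound : (G : Graph) (k : ℕ) (v : Fin (n G)) → k ≤ numEdges G →
    missedOrderings G k v * (k * deg G v) ≤ numEdges G * totalCount G
  missedOrderings-bound G k v = misses-orderings-ratio (incident? v) (edges G) k

  uncovered⇒misses-heavy : (G : Graph) (t : ℚ) (k : ℕ) (σ : List (Fin (n G) × Fin (n G))) →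
    ¬ CoversHeavy G t k σ → Any (λ v → Misses (incident? v) k σ) (heavyVertices G t)
  uncovered⇒misses-heavy G t k σ uncovered =
    lose (∈-filter⁺ (heavy? G t) (∈-allFin v) heavy) (λ endpoint → ¬covered (λ _ → endpoint))
    where
    witness = ¬∀⟶∃¬ (n G) _ (λ v → heavy? G t v →-dec any? (incident? v) (take k σ)) uncovered
    v = proj₁ witness
    ¬covered = proj₂ witness
    heavy : Heavy G t v
    heavy = decidable-stable (heavy? G t v) (λ ¬heavy → ¬covered (λ heavy → contradiction heavy ¬heavy))

  totalCount≤goodCount+missed : (G : Graph) (t : ℚ) (k : ℕ) →
    totalCount G ≤ goodCount G t k + sum (map (missedOrderings G k) (heavyVertices G t))
  totalCount≤goodCount+missed G t k =
    union-bound (λ v → misses? (incident? v) k) (heavyVertices G t) (coversHeavy? G t k) (uncovered⇒misses-heavy G t k) (orderings (edges G))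

open import Defs
open HeavyVertices
open import Data.Nat as ℕ using (ℕ; suc)
import Data.Nat.Properties as ℕ
open import Data.Nat.Coprimality as Coprimality using (Coprime; 1-coprimeTo)
open import Data.Nat.DivMod using (_/_; m/n*n≤m; m≡m%n+[m/n]*n; m%n<n)
open import Data.Nat.ListAction using (sum)
open import Data.Integer as ℤ using (+_; -[1+_]; ∣_∣)
import Data.Integer.Properties as ℤ
open import Data.Integer.Tactic.RingSolver using (solve-∀)
open import Data.List using (List; []; _∷_; map; allFin)
open import Data.List.Relation.Unary.All as All using (All; []; _∷_)
open import Data.List.Relation.Unary.All.Properties using (all-filter)
open import Data.Product using (Σ; _×_; _,_; proj₁; proj₂)
open import Data.Rational as ℚ using (ℚ; mkℚ; 0ℚ; 1ℚ; ½; _<_; _≤_; _+_; _*_; _-_; -_; _÷_; 1/_; *≤*; floor; NonNegative; Positive; nonNegative; positive)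
open import Data.Rational.Properties
import Data.Rational.Unnormalised as ℚᵘ
open import Data.Rational.Unnormalised.Properties using () renaming (≃-trans to ≃ᵘ-trans; ≃-sym to ≃ᵘ-sym)
open import Data.Rational.Solver using (module +-*-Solver)
open +-*-Solver using (solve; _:+_; _:*_; :-_; _:=_; con)
open import Relation.Binary.PropositionalEquality using (_≡_; refl; sym; trans; cong; cong₂; subst₂; module ≡-Reasoning)
open import Relation.Nullary.Decidable using (toWitness)

ℕ→ℚ-mkℚ : ∀ a → ℕ→ℚ a ≡ mkℚ (+ a) 0 (Coprimality.sym (1-coprimeTo a))
ℕ→ℚ-mkℚ a = normalize-coprime (Coprimality.sym (1-coprimeTo a))

ℕ→ℚ-nonNeg : ∀ a → NonNegative (ℕ→ℚ a)
ℕ→ℚ-nonNeg a = normalize-nonNeg a 1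

ℕ→ℚ-pos : ∀ {a} → 0 ℕ.< a → Positive (ℕ→ℚ a)
ℕ→ℚ-pos {a} 0<a = normalize-pos a 1 {{_}} {{ℕ.>-nonZero 0<a}}

ℕ→ℚ-+ : ∀ a b → ℕ→ℚ (a ℕ.+ b) ≡ ℕ→ℚ a + ℕ→ℚ b
ℕ→ℚ-+ a b = toℚᵘ-injective (≃ᵘ-trans cross-multiplied (≃ᵘ-sym (toℚᵘ-homo-+ (ℕ→ℚ a) (ℕ→ℚ b))))
  where
  cross-multiplied : ℚᵘ._≃_ (ℚ.toℚᵘ (ℕ→ℚ (a ℕ.+ b))) (ℚ.toℚᵘ (ℕ→ℚ a) ℚᵘ.+ ℚ.toℚᵘ (ℕ→ℚ b))
  cross-multiplied rewrite ℕ→ℚ-mkℚ (a ℕ.+ b) | ℕ→ℚ-mkℚ a | ℕ→ℚ-mkℚ b | ℤ.pos-+ a b = ℚᵘ.*≡* (identity (+ a) (+ b))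
    where
    identity : ∀ x y → (x ℤ.+ y) ℤ.* + 1 ≡ (x ℤ.* + 1 ℤ.+ y ℤ.* + 1) ℤ.* + 1
    identity = solve-∀

ℕ→ℚ-* : ∀ a b → ℕ→ℚ (a ℕ.* b) ≡ ℕ→ℚ a * ℕ→ℚ b
ℕ→ℚ-* a b = toℚᵘ-injective (≃ᵘ-trans cross-multiplied (≃ᵘ-sym (toℚᵘ-homo-* (ℕ→ℚ a) (ℕ→ℚ b))))
  where
  cross-multiplied : ℚᵘ._≃_ (ℚ.toℚᵘ (ℕ→ℚ (a ℕ.* b))) (ℚ.toℚᵘ (ℕ→ℚ a) ℚᵘ.* ℚ.toℚᵘ (ℕ→ℚ b))
  cross-multiplied rewrite ℕ→ℚ-mkℚ (a ℕ.* b) | ℕ→ℚ-mkℚ a | ℕ→ℚ-mkℚ b | ℤ.pos-* a b = ℚᵘ.*≡* refl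

ℕ→ℚ-mono-≤ : ∀ {a b} → a ℕ.≤ b → ℕ→ℚ a ≤ ℕ→ℚ b
ℕ→ℚ-mono-≤ {a} {b} a≤b rewrite ℕ→ℚ-mkℚ a | ℕ→ℚ-mkℚ b = *≤* (ℤ.*-monoʳ-≤-nonNeg (+ 1) (ℤ.+≤+ a≤b))

ℕ→ℚ-cancel-≤ : ∀ {a b} → ℕ→ℚ a ≤ ℕ→ℚ b → a ℕ.≤ b
ℕ→ℚ-cancel-≤ {a} {b} le rewrite ℕ→ℚ-mkℚ a | ℕ→ℚ-mkℚ b with le
... | *≤* a*1≤b*1 = ℤ.drop‿+≤+ (subst₂ ℤ._≤_ (ℤ.*-identityʳ (+ a)) (ℤ.*-identityʳ (+ b)) a*1≤b*1)

private
  ℕ→ℚ-≤-mkℚ : ∀ a n d .(c : Coprime n (suc d)) → a ℕ.* suc d ℕ.≤ n → ℕ→ℚ a ≤ mkℚ (+ n) d c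
  ℕ→ℚ-≤-mkℚ a n d c le rewrite ℕ→ℚ-mkℚ a =
    *≤* (subst₂ ℤ._≤_ (ℤ.pos-* a (suc d)) (ℤ.pos-* n 1) (ℤ.+≤+ (ℕ.≤-trans le (ℕ.≤-reflexive (sym (ℕ.*-identityʳ n))))))

  mkℚ-≤-ℕ→ℚ : ∀ a n d .(c : Coprime n (suc d)) → n ℕ.≤ a ℕ.* suc d → mkℚ (+ n) d c ≤ ℕ→ℚ a
  mkℚ-≤-ℕ→ℚ a n d c le rewrite ℕ→ℚ-mkℚ a =
    *≤* (subst₂ ℤ._≤_ (ℤ.pos-* n 1) (ℤ.pos-* a (suc d)) (ℤ.+≤+ (ℕ.≤-trans (ℕ.≤-reflexive (ℕ.*-identityʳ n)) le)))

  ∣floor-mkℚ∣ : ∀ n d .(c : Coprime n (suc d)) → ∣ floor (mkℚ (+ n) d c) ∣ ≡ n / suc d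
  ∣floor-mkℚ∣ n d c = trans (ℤ.abs-◃ _ _) (ℕ.+-identityʳ _)

floor-bounds : ∀ q → 0ℚ ≤ q → ℕ→ℚ ∣ floor q ∣ ≤ q × q ≤ ℕ→ℚ (suc ∣ floor q ∣)
floor-bounds (mkℚ (+ n) d c) _ rewrite ∣floor-mkℚ∣ n d c =
  ℕ→ℚ-≤-mkℚ (n / suc d) n d c (m/n*n≤m n (suc d)) , mkℚ-≤-ℕ→ℚ (suc (n / suc d)) n d c n≤[1+n/d]*d
  where
  n≤[1+n/d]*d : n ℕ.≤ suc (n / suc d) ℕ.* suc d
  n≤[1+n/d]*d = ℕ.≤-trans (ℕ.≤-reflexive (m≡m%n+[m/n]*n n (suc d))) (ℕ.+-monoˡ-≤ _ (ℕ.<⇒≤ (m%n<n n (suc d))))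
floor-bounds (mkℚ -[1+ n ] d c) (*≤* ())

sum-scaled-≤ : {V : Set} (f g : V → ℕ) (X Y : ℚ) {vs : List V} → All (λ v → ℕ→ℚ (f v) * X ≤ ℕ→ℚ (g v) * Y) vs →
  ℕ→ℚ (sum (map f vs)) * X ≤ ℕ→ℚ (sum (map g vs)) * Y
sum-scaled-≤ f g X Y []                 = ≤-reflexive (trans (*-zeroˡ X) (sym (*-zeroˡ Y)))
sum-scaled-≤ f g X Y {v ∷ vs} (b ∷ bs) = begin
  ℕ→ℚ (f v ℕ.+ sum (map f vs)) * X               ≡⟨ cong (_* X) (ℕ→ℚ-+ (f v) _) ⟩
  (ℕ→ℚ (f v) + ℕ→ℚ (sum (map f vs))) * X          ≡⟨ *-distribʳ-+ X (ℕ→ℚ (f v)) _ ⟩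
  ℕ→ℚ (f v) * X + ℕ→ℚ (sum (map f vs)) * X        ≤⟨ +-mono-≤ b (sum-scaled-≤ f g X Y bs) ⟩
  ℕ→ℚ (g v) * Y + ℕ→ℚ (sum (map g vs)) * Y        ≡⟨ sym (*-distribʳ-+ Y (ℕ→ℚ (g v)) _) ⟩
  (ℕ→ℚ (g v) + ℕ→ℚ (sum (map g vs))) * Y          ≡⟨ cong (_* Y) (sym (ℕ→ℚ-+ (g v) _)) ⟩
  ℕ→ℚ (g v ℕ.+ sum (map g vs)) * Y               ∎
  where open ≤-Reasoning

missed-weight-≤ : ∀ a k d b (t : ℚ) → .{{NonNegative t}} → t ≤ ℕ→ℚ d → a ℕ.* (k ℕ.* d) ℕ.≤ b →
  ℕ→ℚ a * (ℕ→ℚ k * (t * t)) ≤ ℕ→ℚ d * ℕ→ℚ b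
missed-weight-≤ a k d b t t≤d akd≤b = begin
  A * (K * (t * t))                ≡⟨ sym (*-assoc A K (t * t)) ⟩
  A * K * (t * t)                  ≤⟨ *-monoˡ-≤-nonNeg (A * K) {{nonNeg*nonNeg⇒nonNeg A {{ℕ→ℚ-nonNeg a}} K {{ℕ→ℚ-nonNeg k}}}} t²≤d² ⟩
  A * K * (D * D)                  ≡⟨ regroup A K D ⟩
  A * (K * D) * D                  ≡⟨ cong (_* D) (sym (trans (ℕ→ℚ-* a (k ℕ.* d)) (cong (A *_) (ℕ→ℚ-* k d)))) ⟩
  ℕ→ℚ (a ℕ.* (k ℕ.* d)) * D       ≤⟨ *-monoʳ-≤-nonNeg D {{ℕ→ℚ-nonNeg d}} (ℕ→ℚ-mono-≤ akd≤b) ⟩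
  ℕ→ℚ b * D                        ≡⟨ *-comm (ℕ→ℚ b) D ⟩
  D * ℕ→ℚ b                        ∎
  where
  open ≤-Reasoning
  A = ℕ→ℚ a
  K = ℕ→ℚ k
  D = ℕ→ℚ d
  t²≤d² : t * t ≤ D * D
  t²≤d² = ≤-trans (*-monoʳ-≤-nonNeg t t≤d) (*-monoˡ-≤-nonNeg D {{ℕ→ℚ-nonNeg d}} t≤d)
  regroup : ∀ A K D → A * K * (D * D) ≡ A * (K * D) * D
  regroup = solve 3 (λ A K D → A :* K :* (D :* D) := A :* (K :* D) :* D) refl

failure-bound : ∀ (T Gd S W M δ : ℚ) → .{{Positive M}} → .{{NonNegative S}} → .{{NonNegative δ}} →
  T ≤ Gd + S → S * W ≤ ℕ→ℚ 2 * M * (M * T) → ℕ→ℚ 4 * (M * M) ≤ W * δ → (1ℚ - ½ * δ) * T ≤ Gd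
failure-bound T Gd S W M δ T≤Gd+S SW≤2M²T 4M²≤Wδ = begin
  (1ℚ - ½ * δ) * T     ≡⟨ expand T δ ⟩
  T + - (½ * δ * T)    ≤⟨ +-monoʳ-≤ T (neg-antimono-≤ S≤½δT) ⟩
  T + - S              ≤⟨ +-monoˡ-≤ (- S) T≤Gd+S ⟩
  Gd + S + - S         ≡⟨ cancel Gd S ⟩
  Gd                   ∎
  where
  open ≤-Reasoning
  F = ℕ→ℚ 4 * (M * M)
  instance
    F-pos : Positive F
    F-pos = pos*pos⇒pos (ℕ→ℚ 4) (M * M) {{pos*pos⇒pos M M}}
  S≤½δT : S ≤ ½ * δ * T
  S≤½δT = *-cancelˡ-≤-pos F (begin
    F * S                      ≤⟨ *-monoʳ-≤-nonNeg S 4M²≤Wδ ⟩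
    W * δ * S                  ≡⟨ reorder S W δ ⟩
    S * W * δ                  ≤⟨ *-monoʳ-≤-nonNeg δ SW≤2M²T ⟩
    ℕ→ℚ 2 * M * (M * T) * δ    ≡⟨ halve M T δ ⟩
    F * (½ * δ * T)            ∎)
    where
    reorder : ∀ S W δ → W * δ * S ≡ S * W * δ
    reorder = solve 3 (λ S W δ → W :* δ :* S := S :* W :* δ) refl
    halve : ∀ M T δ → ℕ→ℚ 2 * M * (M * T) * δ ≡ ℕ→ℚ 4 * (M * M) * (½ * δ * T)
    halve = solve 3 (λ M T δ → con (ℕ→ℚ 2) :* M :* (M :* T) :* δ := con (ℕ→ℚ 4) :* (M :* M) :* (con ½ :* δ :* T)) refl
  expand : ∀ T δ → (1ℚ - ½ * δ) * T ≡ T + - (½ * δ * T)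
  expand = solve 2 (λ T δ → (con 1ℚ :+ :- (con ½ :* δ)) :* T := T :+ :- (con ½ :* δ :* T)) refl
  cancel : ∀ G S → G + S + - S ≡ G
  cancel = solve 2 (λ G S → G :+ S :+ :- S := G) refl

coversHeavy-probability : (G : Graph) (t δ : ℚ) (k : ℕ) → .{{NonNegative t}} → .{{NonNegative δ}} →
  0 ℕ.< numEdges G → k ℕ.≤ numEdges G → ℕ→ℚ 4 * (ℕ→ℚ (numEdges G) * ℕ→ℚ (numEdges G)) ≤ ℕ→ℚ k * (t * t) * δ →
  ProbAtLeast G t k (1ℚ - ½ * δ)
coversHeavy-probability G t δ k 0<m k≤m 4M²≤Kt²δ =
  failure-bound T (ℕ→ℚ (goodCount G t k)) S W M δ {{ℕ→ℚ-pos 0<m}} {{ℕ→ℚ-nonNeg missed}}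
    T≤good+S SW≤2M²T 4M²≤Kt²δ
  where
  m = numEdges G
  M = ℕ→ℚ m
  T = ℕ→ℚ (totalCount G)
  W = ℕ→ℚ k * (t * t)
  missed = sum (map (missedOrderings G k) (heavyVertices G t))
  S = ℕ→ℚ missed
  T≤good+S : T ≤ ℕ→ℚ (goodCount G t k) + S
  T≤good+S = ≤-trans (ℕ→ℚ-mono-≤ (totalCount≤goodCount+missed G t k)) (≤-reflexive (ℕ→ℚ-+ (goodCount G t k) missed))
  per-vertex : ∀ {v} → Heavy G t v → ℕ→ℚ (missedOrderings G k v) * W ≤ ℕ→ℚ (deg G v) * ℕ→ℚ (m ℕ.* totalCount G)
  per-vertex {v} heavy = missed-weight-≤ (missedOrderings G k v) k (deg G v) _ t heavy (missedOrderings-bound G k v k≤m)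
  SW≤2M²T : S * W ≤ ℕ→ℚ 2 * M * (M * T)
  SW≤2M²T = begin
    S * W                                                      ≤⟨ sum-scaled-≤ (missedOrderings G k) (deg G) W mT heavy-bounds ⟩
    ℕ→ℚ (sum (map (deg G) (heavyVertices G t))) * mT           ≤⟨ *-monoʳ-≤-nonNeg mT {{ℕ→ℚ-nonNeg (m ℕ.* totalCount G)}} (ℕ→ℚ-mono-≤ (heavy-degree-sum-≤ G t)) ⟩
    ℕ→ℚ (2 ℕ.* m) * mT                                         ≡⟨ cong₂ _*_ (ℕ→ℚ-* 2 m) (ℕ→ℚ-* m (totalCount G)) ⟩
    ℕ→ℚ 2 * M * (M * T)                                        ∎
    where
    open ≤-Reasoning
    mT = ℕ→ℚ (m ℕ.* totalCount G)
    heavy-bounds = All.map per-vertex (all-filter (heavy? G t) (allFin (n G)))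

UnitInterval : ℚ → Set
UnitInterval x = 0ℚ ≤ x × x ≤ 1ℚ

*-unitInterval : ∀ {x y} → UnitInterval x → UnitInterval y → UnitInterval (x * y)
*-unitInterval {x} {y} (0≤x , x≤1) (0≤y , y≤1) =
  nonNegative⁻¹ (x * y) {{nonNeg*nonNeg⇒nonNeg x {{nonNegative 0≤x}} y {{nonNegative 0≤y}}}} ,
  ≤-trans (*-monoʳ-≤-nonNeg y {{nonNegative 0≤y}} x≤1) (≤-trans (≤-reflexive (*-identityˡ y)) y≤1)

-- 25600 = 4 · 80², where 80 comes from c = 80 / δ.
weight-bound : ∀ (K t M δ ε : ℚ) → .{{NonNegative (M * M)}} → t * ℕ→ℚ 80 ≡ ε * ε * M * δ →
  ℕ→ℚ 25600 ≤ K * (δ * δ * δ * (ε * ε * ε * ε)) → ℕ→ℚ 4 * (M * M) ≤ K * (t * t) * δ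
weight-bound K t M δ ε t80≡ε²Mδ 25600≤Ku = *-cancelˡ-≤-pos (ℕ→ℚ 6400) (begin
  ℕ→ℚ 6400 * (ℕ→ℚ 4 * (M * M))                        ≡⟨ reassociate (M * M) ⟩
  ℕ→ℚ 25600 * (M * M)                                  ≤⟨ *-monoʳ-≤-nonNeg (M * M) 25600≤Ku ⟩
  K * (δ * δ * δ * (ε * ε * ε * ε)) * (M * M)          ≡⟨ square K δ ε M ⟩
  K * (ε * ε * M * δ) * (ε * ε * M * δ) * δ            ≡⟨ cong (λ x → K * x * x * δ) (sym t80≡ε²Mδ) ⟩
  K * (t * ℕ→ℚ 80) * (t * ℕ→ℚ 80) * δ                  ≡⟨ unsquare K t δ ⟩
  ℕ→ℚ 6400 * (K * (t * t) * δ)                         ∎)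
  where
  open ≤-Reasoning
  reassociate : ∀ X → ℕ→ℚ 6400 * (ℕ→ℚ 4 * X) ≡ ℕ→ℚ 25600 * X
  reassociate = solve 1 (λ X → con (ℕ→ℚ 6400) :* (con (ℕ→ℚ 4) :* X) := con (ℕ→ℚ 25600) :* X) refl
  square : ∀ K δ ε M → K * (δ * δ * δ * (ε * ε * ε * ε)) * (M * M) ≡ K * (ε * ε * M * δ) * (ε * ε * M * δ) * δ
  square = solve 4 (λ K δ ε M → K :* (δ :* δ :* δ :* (ε :* ε :* ε :* ε)) :* (M :* M) := K :* (ε :* ε :* M :* δ) :* (ε :* ε :* M :* δ) :* δ) refl
  unsquare : ∀ K t δ → K * (t * ℕ→ℚ 80) * (t * ℕ→ℚ 80) * δ ≡ ℕ→ℚ 6400 * (K * (t * t) * δ)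
  unsquare = solve 3 (λ K t δ → K :* (t :* con (ℕ→ℚ 80)) :* (t :* con (ℕ→ℚ 80)) :* δ := con (ℕ→ℚ 6400) :* (K :* (t :* t) :* δ)) refl

÷-*-cancel : ∀ p q .{{_ : ℚ.NonZero q}} → (p ÷ q) * q ≡ p
÷-*-cancel p q = trans (*-assoc p (1/ q) q) (trans (cong (p *_) (*-inverseˡ q)) (*-identityʳ p))

module Parameters {β ε δ : ℚ} (25601≤β : ℕ→ℚ 25601 ≤ β) (0<ε : 0ℚ < ε) (ε≤½ : ε ≤ ½) (0<δ : 0ℚ < δ) (δ<1 : δ < 1ℚ)
                  (G : Graph) (s≤m : sParam β δ ε 0<δ 0<ε ≤ ℕ→ℚ (numEdges G)) where

  s = sParam β δ ε 0<δ 0<ε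
  u = δ * δ * δ * (ε * ε * ε * ε)
  k = ∣ floor s ∣
  K = ℕ→ℚ k
  c = cParam δ 0<δ
  t = threshold G δ ε 0<δ
  M = ℕ→ℚ (numEdges G)

  instance
    δ-pos : Positive δ
    δ-pos = positive 0<δ
    δ-nonZero : ℚ.NonZero δ
    δ-nonZero = pos⇒nonZero δ
    ε-pos : Positive ε
    ε-pos = positive 0<ε
    u-pos : Positive u
    u-pos = pos*pos⇒pos (δ * δ * δ) {{pos*pos⇒pos (δ * δ) {{pos*pos⇒pos δ δ}} δ}}
                        (ε * ε * ε * ε) {{pos*pos⇒pos (ε * ε * ε) {{pos*pos⇒pos (ε * ε) {{pos*pos⇒pos ε ε}} ε}} ε}}
    u-nonZero : ℚ.NonZero u
    u-nonZero = pos⇒nonZero u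
    c-pos : Positive c
    c-pos = pos*pos⇒pos (ℕ→ℚ 80) (1/ δ) {{1/pos⇒pos δ}}
    c-nonZero : ℚ.NonZero c
    c-nonZero = pos⇒nonZero c
    M-nonNeg : NonNegative M
    M-nonNeg = ℕ→ℚ-nonNeg (numEdges G)

  δ-nonNeg : NonNegative δ
  δ-nonNeg = pos⇒nonNeg δ

  s*u≡β : s * u ≡ β
  s*u≡β = ÷-*-cancel β u

  u-unit : UnitInterval u
  u-unit = *-unitInterval (*-unitInterval (*-unitInterval δ-unit δ-unit) δ-unit)
                          (*-unitInterval (*-unitInterval (*-unitInterval ε-unit ε-unit) ε-unit) ε-unit)
    where
    δ-unit : UnitInterval δ
    δ-unit = <⇒≤ 0<δ , <⇒≤ δ<1
    ε-unit : UnitInterval ε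
    ε-unit = <⇒≤ 0<ε , ≤-trans ε≤½ (toWitness {a? = ½ ≤? 1ℚ} _)

  0<s : 0ℚ < s
  0<s = positive⁻¹ s {{pos*pos⇒pos β {{positive 0<β}} (1/ u) {{1/pos⇒pos u}}}}
    where
    0<β : 0ℚ < β
    0<β = <-≤-trans (toWitness {a? = 0ℚ <? ℕ→ℚ 25601} _) 25601≤β

  k≤s×s≤1+k : K ≤ s × s ≤ ℕ→ℚ (suc k)
  k≤s×s≤1+k = floor-bounds s (<⇒≤ 0<s)

  k≤m : k ℕ.≤ numEdges G
  k≤m = ℕ→ℚ-cancel-≤ (≤-trans (proj₁ k≤s×s≤1+k) s≤m)

  0<m : 0 ℕ.< numEdges G
  0<m = ℕ.≰⇒> (λ m≤0 → <-irrefl refl (<-≤-trans 0<s (≤-trans s≤m (ℕ→ℚ-mono-≤ m≤0))))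

  25600≤Ku : ℕ→ℚ 25600 ≤ K * u
  25600≤Ku = begin
    ℕ→ℚ 25600                ≡⟨⟩
    - 1ℚ + ℕ→ℚ 25601         ≤⟨ +-monoʳ-≤ (- 1ℚ) 25601≤β ⟩
    - 1ℚ + β                 ≡⟨ cong (λ x → - 1ℚ + x) (sym s*u≡β) ⟩
    - 1ℚ + s * u             ≤⟨ +-monoʳ-≤ (- 1ℚ) (*-monoʳ-≤-nonNeg u {{pos⇒nonNeg u}} (proj₂ k≤s×s≤1+k)) ⟩
    - 1ℚ + ℕ→ℚ (suc k) * u   ≡⟨ cong (λ x → - 1ℚ + x * u) (ℕ→ℚ-+ 1 k) ⟩
    - 1ℚ + (1ℚ + K) * u      ≡⟨ regroup K u ⟩
    (u - 1ℚ) + K * u         ≤⟨ +-monoˡ-≤ (K * u) (+-monoˡ-≤ (- 1ℚ) (proj₂ u-unit)) ⟩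
    0ℚ + K * u               ≡⟨ +-identityˡ (K * u) ⟩
    K * u                    ∎
    where
    open ≤-Reasoning
    regroup : ∀ K u → - 1ℚ + (1ℚ + K) * u ≡ (u - 1ℚ) + K * u
    regroup = solve 2 (λ K u → :- con 1ℚ :+ (con 1ℚ :+ K) :* u := (u :+ :- con 1ℚ) :+ K :* u) refl

  t*80≡ε²Mδ : t * ℕ→ℚ 80 ≡ ε * ε * M * δ
  t*80≡ε²Mδ = begin
    t * ℕ→ℚ 80         ≡⟨ cong (t *_) (sym (÷-*-cancel (ℕ→ℚ 80) δ)) ⟩
    t * (c * δ)        ≡⟨ sym (*-assoc t c δ) ⟩
    t * c * δ          ≡⟨ cong (_* δ) (÷-*-cancel (ε * ε * M) c) ⟩
    ε * ε * M * δ      ∎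
    where open ≡-Reasoning

  t-nonNeg : NonNegative t
  t-nonNeg = nonNeg*nonNeg⇒nonNeg (ε * ε * M) {{ε²M-nonNeg}} (1/ c) {{pos⇒nonNeg (1/ c) {{1/pos⇒pos c}}}}
    where
    ε²M-nonNeg : NonNegative (ε * ε * M)
    ε²M-nonNeg = nonNeg*nonNeg⇒nonNeg (ε * ε) {{pos⇒nonNeg (ε * ε) {{pos*pos⇒pos ε ε}}}} M

  weight : ℕ→ℚ 4 * (M * M) ≤ K * (t * t) * δ
  weight = weight-bound K t M δ ε {{nonNeg*nonNeg⇒nonNeg M M}} t*80≡ε²Mδ 25600≤Ku

mainTheorem7 : Σ ℚ (λ β₀ → (β : ℚ) → β₀ ≤ β → (ε δ : ℚ) → (0<ε : 0ℚ < ε) → ε ≤ ½ → (0<δ : 0ℚ < δ) → δ < 1ℚ → (G : Graph) → sParam β δ ε 0<δ 0<ε ≤ ℕ→ℚ (numEdges G) → ProbAtLeast G (threshold G δ ε 0<δ) ∣ floor (sParam β δ ε 0<δ 0<ε) ∣ (1ℚ - ½ * δ))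
mainTheorem7 = ℕ→ℚ 25601 , λ β 25601≤β ε δ 0<ε ε≤½ 0<δ δ<1 G s≤m →
  let open Parameters 25601≤β 0<ε ε≤½ 0<δ δ<1 G s≤m
  in coversHeavy-probability G t δ k {{t-nonNeg}} {{δ-nonNeg}} 0<m k≤m weight
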